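{- Let $s,n\in\mathbb{N}$ with $1\le s\le n-2$, let $\boldsymbol a=(a_{n-1},\dots,a_{n-s})\in\mathbb{F}_q^s$ and $f_{\boldsymbol a}:=T^n+a_{n-1}T^{n-1}+\dots+a_{n-s}T^{n-s}$, and let $r$ be an integer with $n-s+1\le r\le n$. Let $X_1,\dots,X_r$ be indeterminates, $Q:=(T-X_1)\cdots(T-X_r)\in\mathbb{F}_q[X_1,\dots,X_r][T]$, and let $R_{\boldsymbol a}=\sum_{j=0}^{r-1}R^{\boldsymbol a}_j(X_1,\dots,X_r)T^j\in\mathbb{F}_q[X_1,\dots,X_r][T]$ be the polynomial of degree at most $r-1$ in $T$ with $f_{\boldsymbol a}\equiv R_{\boldsymbol a}\pmod Q$. Let $\mathcal{X}_r:=\{x_1,\dots,x_r\}\subset\mathbb{F}_q$ be a set with $r$ elements and $$\mathcal{S}^{\boldsymbol a}_{\mathcal{X}_r}:=\{g\in\mathbb{F}_q[T]:\ \deg g\le n-s-1,\ (f_{\boldsymbol a}+g)(x)=0\ \text{for all }x\in\mathcal{X}_r\}.$$ Then $\mathcal{S}^{\boldsymbol a}_{\mathcal{X}_r}$ is nonempty if and only if $R^{\boldsymbol a}_j(x_1,\dots,x_r)=0$ for all $n-s\le j\le r-1$.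
   Context: $\mathbb{F}_q$ is a finite field; the zero polynomial counts as having degree at most $n-s-1$. -}

module Defs where

open import Level using (_⊔_)
open import Algebra.Bundles using (CommutativeRing)
open import Data.Nat using (ℕ; zero; suc)
open import Data.List using (List; []; _∷_; _++_; replicate; foldr)
open import Data.List.Relation.Unary.Any using (Any)
open import Data.Vec using (Vec)
open import Data.Fin using (Fin)
open import Data.Product using (Σ; ∃)
open import Relation.Nullary using (¬_)

record IsField {c ℓ} (F : CommutativeRing c ℓ) : Set (c ⊔ ℓ) where
  open CommutativeRing F
  field
    0≉1     : ¬ (0# ≈ 1#)
    inverse : ∀ x → ¬ (x ≈ 0#) → ∃ λ y → (x * y) ≈ 1#

IsFinite : ∀ {c ℓ} (F : CommutativeRing c ℓ) → Set (c ⊔ ℓ)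
IsFinite F = Σ (List Carrier) λ xs → ∀ y → Any (y ≈_) xs
  where open CommutativeRing F

-- Univariate polynomials over a commutative ring, as coefficient lists
-- (lowest degree first; trailing zeros allowed, equality is coefficientwise).
module Poly {c ℓ} (F : CommutativeRing c ℓ) where
  open CommutativeRing F

  Pol : Set c
  Pol = List Carrier

  coeff : Pol → ℕ → Carrier
  coeff []       _       = 0#
  coeff (a ∷ p)  zero    = a
  coeff (a ∷ p)  (suc k) = coeff p k

  _≈ₚ_ : Pol → Pol → Set ℓ
  p ≈ₚ q = ∀ k → coeff p k ≈ coeff q k

  _+ₚ_ : Pol → Pol → Pol
  []      +ₚ q       = q
  (a ∷ p) +ₚ []      = a ∷ p
  (a ∷ p) +ₚ (b ∷ q) = (a + b) ∷ (p +ₚ q)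

  scale : Carrier → Pol → Pol
  scale a []      = []
  scale a (b ∷ q) = (a * b) ∷ scale a q

  _*ₚ_ : Pol → Pol → Pol
  []      *ₚ q = []
  (a ∷ p) *ₚ q = scale a q +ₚ (0# ∷ (p *ₚ q))

  eval : Pol → Carrier → Carrier
  eval []      x = 0#
  eval (a ∷ p) x = a + x * eval p x

  T-_ : Carrier → Pol
  T- x = (- x) ∷ 1# ∷ []

  prodLin : List Carrier → Pol
  prodLin = foldr (λ x p → (T- x) *ₚ p) (1# ∷ [])

  -- f_a = T^n + a_{n-1} T^{n-1} + ... + a_{n-s} T^{n-s}, where the list
  -- as = (a_{n-s}, ..., a_{n-1}) has length s and m = n - s.
  fa : (m : ℕ) → List Carrier → Pol
  fa m as = replicate m 0# ++ (as ++ (1# ∷ []))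

module Submission where

-- Write f = f_a, Q = (T - x_1)⋯(T - x_r) and f = Q·h + R with
-- deg R < r.  Since Q vanishes at every x_i, f and R take the same values on
-- the x_i, so f + g vanishes there iff R + g does.  The polynomial R + g has
-- fewer than r coefficients, hence (over a field, the x_i being distinct) it
-- vanishes at all x_i iff it is the zero polynomial.  With deg g < m = n - s
-- this is possible iff the coefficients of R of degree ≥ m vanish, and then
-- g = -(low part of R) is a witness.

open import Defs
open import Algebra.Bundles using (CommutativeRing)
open import Data.Nat using (ℕ; zero; suc; z≤n; s≤s; _<_; _<?_; pred; _∸_; _≤_)
  renaming (_+_ to _+ℕ_)
import Data.Nat.Properties as ℕP
open import Data.List using ([]; _∷_; length)
open import Data.Vec using (Vec; []; _∷_; toList; lookup)
open import Data.Fin using (Fin; toℕ)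
import Data.Fin as Fin
import Data.Fin.Properties as FinP
open import Data.Product using (Σ; ∃; _,_)
open import Data.Maybe using (nothing)
open import Function.Bundles using (_⇔_; mk⇔)
open import Relation.Nullary using (¬_; yes; no)
open import Relation.Binary.PropositionalEquality as P using (_≡_)

module RingFacts {c ℓ} (F : CommutativeRing c ℓ) where
  open CommutativeRing F hiding (zero)
  open Poly F public
  open import Algebra.Solver.Ring.NaturalCoefficients commutativeSemiring (λ _ _ → nothing)
    public

  coeff-+ : ∀ p q k → coeff (p +ₚ q) k ≈ coeff p k + coeff q k
  coeff-+ []      q       k       = sym (+-identityˡ _)
  coeff-+ (a ∷ p) []      k       = sym (+-identityʳ _)
  coeff-+ (a ∷ p) (b ∷ q) zero    = refl
  coeff-+ (a ∷ p) (b ∷ q) (suc k) = coeff-+ p q k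

  coeff-lookup : ∀ {r} (v : Vec Carrier r) j → coeff (toList v) (toℕ j) ≡ lookup v j
  coeff-lookup (b ∷ v) Fin.zero    = P.refl
  coeff-lookup (b ∷ v) (Fin.suc j) = coeff-lookup v j

  coeff-beyond : ∀ {m} (v : Vec Carrier m) k → m ≤ k → coeff (toList v) k ≡ 0#
  coeff-beyond []      k       _         = P.refl
  coeff-beyond (b ∷ v) (suc k) (s≤s m≤k) = coeff-beyond v k m≤k

  eval-+ : ∀ p q y → eval (p +ₚ q) y ≈ eval p y + eval q y
  eval-+ []      q       y = sym (+-identityˡ _)
  eval-+ (a ∷ p) []      y = sym (+-identityʳ _)
  eval-+ (a ∷ p) (b ∷ q) y =
    trans (+-congˡ (*-congˡ (eval-+ p q y)))
      (solve 5 (λ a b y P Q → (a :+ b) :+ y :* (P :+ Q) := (a :+ y :* P) :+ (b :+ y :* Q))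
             refl a b y (eval p y) (eval q y))

  eval-scale : ∀ a q y → eval (scale a q) y ≈ a * eval q y
  eval-scale a []      y = sym (zeroʳ a)
  eval-scale a (b ∷ q) y =
    trans (+-congˡ (*-congˡ (eval-scale a q y)))
      (solve 4 (λ a b y Q → a :* b :+ y :* (a :* Q) := a :* (b :+ y :* Q))
             refl a b y (eval q y))

  eval-* : ∀ p q y → eval (p *ₚ q) y ≈ eval p y * eval q y
  eval-* []      q y = sym (zeroˡ _)
  eval-* (a ∷ p) q y =
    trans (eval-+ (scale a q) (0# ∷ (p *ₚ q)) y)
      (trans (+-cong (eval-scale a q y) (trans (+-identityˡ _) (*-congˡ (eval-* p q y))))
        (solve 4 (λ a y P Q → a :* Q :+ y :* (P :* Q) := (a :+ y :* P) :* Q)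
               refl a y (eval p y) (eval q y)))

  eval-zero : ∀ p y → p ≈ₚ [] → eval p y ≈ 0#
  eval-zero []      y p≈0 = refl
  eval-zero (a ∷ p) y p≈0 =
    trans (+-cong (p≈0 zero) (trans (*-congˡ (eval-zero p y (λ k → p≈0 (suc k)))) (zeroʳ y)))
          (+-identityʳ 0#)

  eval-cong : ∀ p q y → p ≈ₚ q → eval p y ≈ eval q y
  eval-cong []      q       y p≈q = sym (eval-zero q y (λ k → sym (p≈q k)))
  eval-cong (a ∷ p) []      y p≈q = eval-zero (a ∷ p) y p≈q
  eval-cong (a ∷ p) (b ∷ q) y p≈q =
    +-cong (p≈q zero) (*-congˡ (eval-cong p q y (λ k → p≈q (suc k))))

  eval-pt : ∀ p {y z} → y ≈ z → eval p y ≈ eval p z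
  eval-pt []      y≈z = refl
  eval-pt (a ∷ p) y≈z = +-congˡ (*-cong y≈z (eval-pt p y≈z))

  eval-T- : ∀ x → eval (T- x) x ≈ 0#
  eval-T- x =
    trans (+-congˡ (trans (*-congˡ (trans (+-congˡ (zeroʳ x)) (+-identityʳ 1#))) (*-identityʳ x)))
          (-‿inverseˡ x)

  eval-prodLin : ∀ {r} (xs : Vec Carrier r) i → eval (prodLin (toList xs)) (lookup xs i) ≈ 0#
  eval-prodLin (y ∷ ys) Fin.zero =
    trans (eval-* (T- y) (prodLin (toList ys)) y) (trans (*-congʳ (eval-T- y)) (zeroˡ _))
  eval-prodLin (y ∷ ys) (Fin.suc i) =
    trans (eval-* (T- y) (prodLin (toList ys)) (lookup ys i))
          (trans (*-congˡ (eval-prodLin ys i)) (zeroʳ _))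

  eval-remainder : ∀ {r} (xs : Vec Carrier r) f h R →
                   f ≈ₚ ((prodLin (toList xs) *ₚ h) +ₚ R) →
                   ∀ i → eval f (lookup xs i) ≈ eval R (lookup xs i)
  eval-remainder xs f h R f≡Qh+R i =
    trans (eval-cong f ((Q *ₚ h) +ₚ R) y f≡Qh+R)
      (trans (eval-+ (Q *ₚ h) R y)
        (trans (+-congʳ (trans (eval-* Q h y) (trans (*-congʳ (eval-prodLin xs i)) (zeroˡ _))))
               (+-identityˡ _)))
    where
    Q = prodLin (toList xs)
    y = lookup xs i

  -- Synthetic division by T - x: quotient x p is the quotient of p by T - x,
  -- with one coefficient fewer than p.
  quotient : Carrier → Pol → Pol
  quotient x []          = []
  quotient x (a ∷ [])    = []
  quotient x (a ∷ b ∷ p) = eval (b ∷ p) x ∷ quotient x (b ∷ p)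

  length-quotient : ∀ x p → length (quotient x p) ≡ pred (length p)
  length-quotient x []          = P.refl
  length-quotient x (a ∷ [])    = P.refl
  length-quotient x (a ∷ b ∷ p) = P.cong suc (length-quotient x (b ∷ p))

  division-identity : ∀ p x d → eval p (x + d) ≈ eval p x + d * eval (quotient x p) (x + d)
  division-identity [] x d = sym (trans (+-identityˡ _) (zeroʳ d))
  division-identity (a ∷ []) x d =
    trans (+-congˡ (zeroʳ _))
      (trans (sym (+-identityʳ _)) (sym (+-cong (+-congˡ (zeroʳ x)) (zeroʳ d))))
  division-identity (a ∷ b ∷ p) x d =
    trans (+-congˡ (*-congˡ (division-identity (b ∷ p) x d)))
      (solve 5 (λ a x d P Q → a :+ (x :+ d) :* (P :+ d :* Q)
                              := (a :+ x :* P) :+ d :* (P :+ (x :+ d) :* Q))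
             refl a x d (eval (b ∷ p) x) (eval (quotient x (b ∷ p)) (x + d)))

  zero-by-quotient : ∀ x p → eval p x ≈ 0# → quotient x p ≈ₚ [] → p ≈ₚ []
  zero-by-quotient x [] px≈0 q≈0 k = refl
  zero-by-quotient x (a ∷ []) px≈0 q≈0 zero =
    trans (sym (+-identityʳ a)) (trans (+-congˡ (sym (zeroʳ x))) px≈0)
  zero-by-quotient x (a ∷ []) px≈0 q≈0 (suc k) = refl
  zero-by-quotient x (a ∷ b ∷ p) px≈0 q≈0 zero =
    trans (sym (+-identityʳ a)) (trans (+-congˡ (trans (sym (zeroʳ x)) (*-congˡ (sym (q≈0 zero))))) px≈0)
  zero-by-quotient x (a ∷ b ∷ p) px≈0 q≈0 (suc k) =
    zero-by-quotient x (b ∷ p) (q≈0 zero) (λ k → q≈0 (suc k)) k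

  x+[y-x]≈y : ∀ x y → x + (y - x) ≈ y
  x+[y-x]≈y x y =
    trans (+-comm x _) (trans (+-assoc y (- x) x) (trans (+-congˡ (-‿inverseˡ x)) (+-identityʳ y)))

  negLowPart : (m : ℕ) → Pol → Vec Carrier m
  negLowPart zero    _       = []
  negLowPart (suc m) []      = - 0# ∷ negLowPart m []
  negLowPart (suc m) (b ∷ p) = - b ∷ negLowPart m p

  coeff-negLowPart : ∀ m p k → k < m → coeff (toList (negLowPart m p)) k ≡ - coeff p k
  coeff-negLowPart (suc m) []      zero    _         = P.refl
  coeff-negLowPart (suc m) []      (suc k) (s≤s k<m) = coeff-negLowPart m [] k k<m
  coeff-negLowPart (suc m) (b ∷ p) zero    _         = P.refl
  coeff-negLowPart (suc m) (b ∷ p) (suc k) (s≤s k<m) = coeff-negLowPart m p k k<m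

  high-coeffs : ∀ {r} m (R : Vec Carrier r) → (∀ (j : Fin r) → m ≤ toℕ j → lookup R j ≈ 0#) →
                ∀ k → m ≤ k → coeff (toList R) k ≈ 0#
  high-coeffs m       []      hyp k       _         = refl
  high-coeffs zero    (b ∷ R) hyp zero    z≤n       = hyp Fin.zero z≤n
  high-coeffs zero    (b ∷ R) hyp (suc k) z≤n       = high-coeffs 0 R (λ j _ → hyp (Fin.suc j) z≤n) k z≤n
  high-coeffs (suc m) (b ∷ R) hyp (suc k) (s≤s m≤k) =
    high-coeffs m R (λ j m≤j → hyp (Fin.suc j) (s≤s m≤j)) k m≤k

  length-+ₚ : ∀ {r} p q → length p ≤ r → length q ≤ r → length (p +ₚ q) ≤ r
  length-+ₚ []      q       _         len-q     = len-q
  length-+ₚ (a ∷ p) []      len-p     _         = len-p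
  length-+ₚ (a ∷ p) (b ∷ q) (s≤s lp) (s≤s lq) = s≤s (length-+ₚ p q lp lq)

  length-toList : ∀ {m} (v : Vec Carrier m) → length (toList v) ≡ m
  length-toList []      = P.refl
  length-toList (b ∷ v) = P.cong suc (length-toList v)

  cancel-low-part : ∀ {r} m (R : Vec Carrier r) → (∀ (j : Fin r) → m ≤ toℕ j → lookup R j ≈ 0#) →
                    (toList R +ₚ toList (negLowPart m (toList R))) ≈ₚ []
  cancel-low-part m R high≈0 k with k <? m
  ... | yes k<m = trans (coeff-+ (toList R) (toList g) k)
                    (trans (+-congˡ (reflexive (coeff-negLowPart m (toList R) k k<m))) (-‿inverseʳ _))
    where g = negLowPart m (toList R)
  ... | no k≮m = trans (coeff-+ (toList R) (toList g) k)
                   (trans (+-cong (high-coeffs m R high≈0 k (ℕP.≮⇒≥ k≮m))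
                                  (reflexive (coeff-beyond g k (ℕP.≮⇒≥ k≮m))))
                          (+-identityˡ 0#))
    where g = negLowPart m (toList R)

module FieldFacts {c ℓ} (F : CommutativeRing c ℓ) (isField : IsField F) where
  open CommutativeRing F hiding (zero)
  open RingFacts F
  open IsField isField

  cancel-nonzero : ∀ d v → ¬ (d ≈ 0#) → d * v ≈ 0# → v ≈ 0#
  cancel-nonzero d v d≉0 dv≈0 with inverse d d≉0
  ... | (d⁻¹ , dd⁻¹≈1) =
    trans (sym (*-identityˡ v)) (trans (*-congʳ (sym dd⁻¹≈1))
      (trans (solve 3 (λ d e v → (d :* e) :* v := e :* (d :* v)) refl d d⁻¹ v)
        (trans (*-congˡ dv≈0) (zeroʳ d⁻¹))))

  quotient-root : ∀ p x y → ¬ (y ≈ x) → eval p x ≈ 0# → eval p y ≈ 0# →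
                  eval (quotient x p) y ≈ 0#
  quotient-root p x y y≉x px≈0 py≈0 =
    trans (eval-pt (quotient x p) (sym (x+[y-x]≈y x y))) (cancel-nonzero d _ d≉0 d·q≈0)
    where
    d = y - x
    d·q≈0 : d * eval (quotient x p) (x + d) ≈ 0#
    d·q≈0 = trans (sym (+-identityˡ _))
              (trans (+-congʳ (sym px≈0))
                (trans (sym (division-identity p x d)) (trans (eval-pt p (x+[y-x]≈y x y)) py≈0)))
    d≉0 : ¬ (d ≈ 0#)
    d≉0 d≈0 = y≉x (trans (sym (x+[y-x]≈y x y)) (trans (+-congˡ d≈0) (+-identityʳ x)))

  root-bound : ∀ {r} (xs : Vec Carrier r) → (∀ i j → lookup xs i ≈ lookup xs j → i ≡ j) →
               ∀ p → length p ≤ r → (∀ i → eval p (lookup xs i) ≈ 0#) → p ≈ₚ []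
  root-bound []       distinct []      _  _     k = refl
  root-bound []       distinct (a ∷ p) () _
  root-bound {suc r} (x ∷ xs) distinct p len≤ vanish =
    zero-by-quotient x p (vanish Fin.zero)
      (root-bound xs distinct′ (quotient x p)
        (P.subst (_≤ r) (P.sym (length-quotient x p)) (ℕP.pred-mono-≤ len≤))
        (λ i → quotient-root p x (lookup xs i) (y≉x i) (vanish Fin.zero) (vanish (Fin.suc i))))
    where
    distinct′ : ∀ i j → lookup xs i ≈ lookup xs j → i ≡ j
    distinct′ i j e = FinP.suc-injective (distinct (Fin.suc i) (Fin.suc j) e)
    y≉x : ∀ i → ¬ (lookup xs i ≈ x)
    y≉x i e with distinct (Fin.suc i) Fin.zero e
    ... | ()

  high-coeffs-vanish : ∀ {r m} (xs : Vec Carrier r) → (∀ i j → lookup xs i ≈ lookup xs j → i ≡ j) →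
                       m ≤ r → (R : Vec Carrier r) (g : Vec Carrier m) →
                       (∀ i → eval (toList R +ₚ toList g) (lookup xs i) ≈ 0#) →
                       ∀ (j : Fin r) → m ≤ toℕ j → lookup R j ≈ 0#
  high-coeffs-vanish {r} xs distinct m≤r R g vanish j m≤j =
    P.subst (_≈ 0#) (coeff-lookup R j)
      (trans (sym (+-identityʳ _))
        (trans (+-congˡ (reflexive (P.sym (coeff-beyond g (toℕ j) m≤j))))
          (trans (sym (coeff-+ (toList R) (toList g) (toℕ j))) (R+g≈0 (toℕ j)))))
    where
    R+g≈0 : (toList R +ₚ toList g) ≈ₚ []
    R+g≈0 = root-bound xs distinct (toList R +ₚ toList g)
              (length-+ₚ (toList R) (toList g) (ℕP.≤-reflexive (length-toList R))
                         (P.subst (_≤ r) (P.sym (length-toList g)) m≤r))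
              vanish

  solvable⇔highCoeffsVanish :
    ∀ {r} m (f : Pol) (xs : Vec Carrier r) → (∀ i j → lookup xs i ≈ lookup xs j → i ≡ j) →
    m ≤ r → (R : Vec Carrier r) → (∃ λ h → f ≈ₚ ((prodLin (toList xs) *ₚ h) +ₚ toList R)) →
    (Σ (Vec Carrier m) λ g → ∀ i → eval (f +ₚ toList g) (lookup xs i) ≈ 0#)
    ⇔ (∀ (j : Fin r) → m ≤ toℕ j → lookup R j ≈ 0#)
  solvable⇔highCoeffsVanish {r} m f xs distinct m≤r R (h , f≡Qh+R) = mk⇔ necessary sufficient
    where
    shift : ∀ (g : Pol) i → eval (f +ₚ g) (lookup xs i) ≈ eval (toList R +ₚ g) (lookup xs i)
    shift g i = trans (eval-+ f g y)
                  (trans (+-congʳ (eval-remainder xs f h (toList R) f≡Qh+R i))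
                         (sym (eval-+ (toList R) g y)))
      where y = lookup xs i

    necessary : (Σ (Vec Carrier m) λ g → ∀ i → eval (f +ₚ toList g) (lookup xs i) ≈ 0#) →
                ∀ (j : Fin r) → m ≤ toℕ j → lookup R j ≈ 0#
    necessary (g , vanish) =
      high-coeffs-vanish xs distinct m≤r R g (λ i → trans (sym (shift (toList g) i)) (vanish i))

    sufficient : (∀ (j : Fin r) → m ≤ toℕ j → lookup R j ≈ 0#) →
                 Σ (Vec Carrier m) λ g → ∀ i → eval (f +ₚ toList g) (lookup xs i) ≈ 0#
    sufficient high≈0 = g , λ i →
      trans (shift (toList g) i) (eval-zero (toList R +ₚ toList g) (lookup xs i) (cancel-low-part m R high≈0))
      where g = negLowPart m (toList R)

-- Lemma 6.2: the case f = f_a and m = n - s.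
lemma6p2 : ∀ {c ℓ} (F : CommutativeRing c ℓ) → IsField F → IsFinite F →
  let open CommutativeRing F
      open Poly F
  in (s n : ℕ) → 1 ≤ s → s +ℕ 2 ≤ n →
     (a : Vec Carrier s) →
     (r : ℕ) → (n ∸ s) +ℕ 1 ≤ r → r ≤ n →
     (x : Vec Carrier r) →
     (∀ i j → lookup x i ≈ lookup x j → i ≡ j) →
     (R : Vec Carrier r) →
     (∃ λ h → fa (n ∸ s) (toList a) ≈ₚ ((prodLin (toList x) *ₚ h) +ₚ toList R)) →
     ((Σ (Vec Carrier (n ∸ s)) λ g →
          ∀ i → eval (fa (n ∸ s) (toList a) +ₚ toList g) (lookup x i) ≈ 0#)
      ⇔ (∀ (j : Fin r) → n ∸ s ≤ toℕ j → lookup R j ≈ 0#))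
lemma6p2 F isField _ s n _ _ a r n-s+1≤r _ x distinct R division =
  FieldFacts.solvable⇔highCoeffsVanish F isField (n ∸ s) (Poly.fa F (n ∸ s) (toList a))
    x distinct (ℕP.≤-trans (ℕP.m≤m+n (n ∸ s) 1) n-s+1≤r) R division
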